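{- Let $G\in\mathrm{Mat}_{k\times n}(\mathbb{Z})$ have no zero column, with lcm period $\rho_0$, and let $m\in\{1,\dots,\rho_0\}$. For $s\in\{0,1,\dots,r(E)\}$ let $\mathcal{J}'_s:=\{J\subseteq E\mid r(E)-r(J)=s\}$, let $\mathcal{J}_s$ be the set of elements of $\mathcal{J}'_s$ of maximum cardinality, let $\iota_s$ be this maximum cardinality, and let $i_s:=n-\iota_s$. Then: (1) $i_0<i_1<\cdots<i_{r(E)}$; (2) $\deg f^m_{i_s}(t)=s$ for every $s\in\{0,1,\dots,r(E)\}$; (3) for $s\in\{0,\dots,r(E)\}$ and $i\in\{0,\dots,n\}$, if $\deg f^m_i(t)=s$ then $i_s\le i$; i.e. $i_s=\min\{i\mid \deg f_i^m(t)=s\}$.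
   Context: $E=\{1,\dots,n\}$. For nonempty $J\subseteq E$, $r(J)$ is the rank of the submatrix $G_J$ of columns indexed by $J$ and $e_{1,J}\mid\cdots\mid e_{r(J),J}$ its elementary divisors; $r(\emptyset)=0$; empty products equal $1$. $\rho_0:=\mathrm{lcm}(e_{r(J),J}\mid\emptyset\ne J\subseteq E)$. For $m\in\{1,\dots,\rho_0\}$ and $i\in\{0,\dots,n\}$, $$f_i^m(t):=\sum_{J\subseteq E,\ |J|=n-i}\ \sum_{K:\,J\subseteq K\subseteq E}(-1)^{|K|-|J|}\frac{\prod_{\ell=1}^{r(K)}\gcd(m,e_{\ell,K})}{\prod_{\ell=1}^{r(E)}\gcd(m,e_{\ell,E})}\,t^{r(E)-r(K)}\in\mathbb{Q}[t].$$ -}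

module Defs where

open import Data.Bool using (Bool; true; false; if_then_else_; not)
open import Data.Nat using (ℕ; zero; suc; _∸_; _≤?_; _≡ᵇ_; _⊓_)
open import Data.Nat.GCD using (gcd)
open import Data.Nat.LCM using (lcm)
import Data.Nat.DivMod as ND
open import Data.Integer using (ℤ) renaming (∣_∣ to abs; _*_ to _*ℤ_; _+_ to _+ℤ_; -_ to -ℤ_; +_ to +ℤ_)
open import Data.Rational using (ℚ; 0ℚ; _+_; -_; _/_)
open import Data.Fin using (Fin; zero; suc; punchIn; toℕ)
open import Data.Fin.Subset using (Subset; inside; outside; ∣_∣; _⊆_)
open import Data.Fin.Subset.Properties using (_∈?_; _⊆?_)
open import Data.List using (List; []; _∷_; map; _++_; foldr; filter; length; allFin; upTo; concatMap)
import Data.List as L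
open import Data.Vec using (Vec; []; _∷_; lookup)
import Data.Vec as V
open import Relation.Nullary.Decidable using (⌊_⌋)
import Data.Nat
import Data.Product
import Relation.Binary.PropositionalEquality

-- Integer matrices are functions  Fin p → Fin q → ℤ  (p rows, q columns).

alt : ℕ → ℤ → ℤ
alt zero    x = x
alt (suc j) x = -ℤ (alt j x)

sumℤ : List ℤ → ℤ
sumℤ = foldr _+ℤ_ (+ℤ 0)

det : ∀ {t} → (Fin t → Fin t → ℤ) → ℤ
det {zero}  A = +ℤ 1
det {suc t} A =
  sumℤ (map (λ j → alt (toℕ j) (A zero j *ℤ det (λ r c → A (suc r) (punchIn j c)))) (allFin (suc t)))

-- strictly increasing t-tuples of elements of Fin q (= t-element subsets)
choose : (t q : ℕ) → List (Vec (Fin q) t)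
choose zero    q       = [] ∷ []
choose (suc t) zero    = []
choose (suc t) (suc q) =
  map (λ v → zero ∷ V.map suc v) (choose t q) ++ map (V.map suc) (choose (suc t) q)

minors : ∀ {p q} → (Fin p → Fin q → ℤ) → (t : ℕ) → List ℤ
minors {p} {q} A t =
  concatMap (λ rs → map (λ cs → det (λ a b → A (lookup rs a) (lookup cs b))) (choose t q)) (choose t p)

detDiv : ∀ {p q} → (Fin p → Fin q → ℤ) → ℕ → ℕ
detDiv A t = foldr (λ x g → gcd (abs x) g) 0 (minors A t)

largest : (ℕ → Bool) → ℕ → ℕ
largest P zero    = 0
largest P (suc N) = if P (suc N) then suc N else largest P N

-- rank: largest t such that some t×t minor is nonzero
rank : ∀ {p q} → (Fin p → Fin q → ℤ) → ℕ
rank {p} {q} A = largest (λ t → not (detDiv A t ≡ᵇ 0)) (p ⊓ q)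

-- division with the (never used) convention a / 0 = 0
_div0_ : ℕ → ℕ → ℕ
a div0 zero  = 0
a div0 suc b = ND._/_ a (suc b)

elemDiv : ∀ {p q} → (Fin p → Fin q → ℤ) → ℕ → ℕ
elemDiv A zero    = 1   -- convention, never used for ℓ ≥ 1
elemDiv A (suc ℓ) = detDiv A (suc ℓ) div0 detDiv A ℓ

allSubsets : (n : ℕ) → List (Subset n)
allSubsets zero    = [] ∷ []
allSubsets (suc n) = map (outside ∷_) (allSubsets n) ++ map (inside ∷_) (allSubsets n)

elems : ∀ {n} → Subset n → List (Fin n)
elems {n} J = filter (_∈? J) (allFin n)

sub : ∀ {k n} → (Fin k → Fin n → ℤ) → (J : Subset n) → Fin k → Fin (length (elems J)) → ℤ
sub G J i c = G i (L.lookup (elems J) c)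

module _ {k n : ℕ} (G : Fin k → Fin n → ℤ) where

  r : Subset n → ℕ
  r J = rank (sub G J)

  e : ℕ → Subset n → ℕ
  e ℓ J = elemDiv (sub G J) ℓ

  rE : ℕ
  rE = rank G

  E : Subset n
  E = V.replicate n inside

  ρ₀ : ℕ
  ρ₀ = foldr lcm 1 (map (λ J → e (r J) J) (filter (λ J → 1 ≤? ∣ J ∣) (allSubsets n)))

  gprod : ℕ → Subset n → ℕ
  gprod m J = foldr Data.Nat._*_ 1 (map (λ ℓ → gcd m (e (suc ℓ) J)) (upTo (r J)))

  -- a / d as a rational (d is always nonzero where used)
  frac : ℤ → ℕ → ℚ
  frac a zero    = 0ℚ
  frac a (suc d) = a / suc d

  sumℚ : List ℚ → ℚ
  sumℚ = foldr _+_ 0ℚ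

  -- coefficient of t^d in f_i^m(t)
  coeff : (m i d : ℕ) → ℚ
  coeff m i d =
    sumℚ (concatMap
      (λ J → map (λ K → if (rE ∸ r K) ≡ᵇ d
                          then frac (alt (∣ K ∣ ∸ ∣ J ∣) (+ℤ gprod m K)) (gprod m E)
                          else 0ℚ)
                 (filter (J ⊆?_) (allSubsets n)))
      (filter (λ J → ∣ J ∣ Data.Nat.≟ (n ∸ i)) (allSubsets n)))

  HasDegree : (m i s : ℕ) → Set
  HasDegree m i s = (coeff m i s Relation.Binary.PropositionalEquality.≢ 0ℚ)
                    Data.Product.× (∀ d → s Data.Nat.< d → coeff m i d Relation.Binary.PropositionalEquality.≡ 0ℚ)

  ι : ℕ → ℕ
  ι s = foldr Data.Nat._⊔_ 0 (map ∣_∣ (filter (λ J → (rE ∸ r J) Data.Nat.≟ s) (allSubsets n)))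

  iₛ : ℕ → ℕ
  iₛ s = n ∸ ι s

module Submission where

open import Defs
open import Data.Nat using (ℕ; suc; _≤_; _<_)
open import Data.Integer using (ℤ; 0ℤ)
open import Data.Fin using (Fin)
open import Data.Product using (_×_; ∃)
open import Relation.Binary.PropositionalEquality using (_≢_)

import Algebra.Properties.CommutativeSemigroup as CommutativeSemigroupProperties
open import Data.Bool using (true; false; not; if_then_else_; T)
open import Data.Empty using (⊥; ⊥-elim)
open import Data.Fin as Fin using (zero; suc; toℕ; punchIn; punchOut; _≟_)
open import Data.Fin.Properties using (punchInᵢ≢i; punchIn-punchOut; injective⇒≤; <-cmp; any?; all?; ¬∀⟶∃¬)
open import Data.Fin.Subset using (Subset; inside; outside; _⊆_; ∣_∣; ⊤; _-_; _∪_; ⁅_⁆; Empty)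
  renaming (_∈_ to _∈ₛ_; _∉_ to _∉ₛ_)
open import Data.Fin.Subset.Properties
  using ( _∈?_; _⊆?_; ⊆-refl; ∈⊤; nonempty?; ∣p∣≤n; p⊆q⇒∣p∣≤∣q∣; p⊂q⇒∣p∣<∣q∣
        ; x∈p∧x≢y⇒x∈p-y; x∈p⇒∣p-x∣<∣p∣; p⊆p∪q; x∈p∪q⁺; x∈p∪q⁻; x∈⁅x⁆; x∈⁅y⁆⇒x≡y )
open import Data.Integer using (_+_; _*_; -_)
import Data.Integer as ℤ
import Data.Integer.Properties as ℤ
open import Data.List as List using (List; []; _∷_; map; foldr; filter; concatMap; allFin; upTo; length)
import Data.List.Properties as List
open import Data.List.Membership.Propositional using (_∈_; find)
open import Data.List.Membership.Propositional.Properties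
  using ( ∈-map⁺; ∈-map⁻; ∈-++⁺ˡ; ∈-++⁺ʳ; ∈-++⁻; ∈-filter⁺; ∈-filter⁻; ∈-concatMap⁺; ∈-concatMap⁻
        ; ∈-lookup; ∈-allFin; foldr-selective )
open import Data.List.Relation.Unary.All as All using (All; []; _∷_)
import Data.List.Relation.Unary.All.Properties as All
open import Data.List.Relation.Unary.AllPairs using (AllPairs; _∷_)
import Data.List.Relation.Unary.AllPairs.Properties as AllPairs
open import Data.List.Relation.Unary.Any as Any using (here; there; index)
open import Data.List.Relation.Unary.Any.Properties using (lookup-index)
open import Data.Nat as ℕ using (zero; _∸_; _⊔_; _⊓_; z≤n; s≤s; NonZero)
import Data.Nat.Properties as ℕ
open import Data.Nat.GCD using (gcd; gcd-identityˡ; gcd[m,n]≢0; gcd[m,n]≡0⇒m≡0; gcd[m,n]≡0⇒n≡0)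
open import Data.Nat.ListAction.Properties using (product≢0)
open import Data.Product using (Σ-syntax; ∃₂; _,_; proj₁; proj₂)
open import Data.Rational as ℚ using (ℚ; 0ℚ)
import Data.Rational.Properties as ℚ
open import Data.Sum as Sum using (_⊎_; inj₁; inj₂)
open import Data.Unit using (tt)
open import Data.Vec as Vec using (Vec; []; _∷_)
import Data.Vec.Properties as Vec
open import Function using (_∘_; id; case_of_)
open import Relation.Binary.Definitions using (Monotonic₁; tri<; tri≈; tri>)
open import Relation.Binary.PropositionalEquality hiding (J)
open import Relation.Nullary using (yes; no)

open import Algebra.Properties.Semiring.Sum ℤ.+-*-semiring
  using (sum; sum-syntax; sum-cong-≗; sum-remove; sum-replicate-zero; ∑-comm; *-distribˡ-sum)
open CommutativeSemigroupProperties ℕ.+-commutativeSemigroup using () renaming (x∙yz≈y∙xz to x+[y+z]≡y+[x+z])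
open CommutativeSemigroupProperties ℤ.*-commutativeSemigroup using () renaming (x∙yz≈y∙xz to x*[y*z]≡y*[x*z])

-- Write defect J = r(E) ∸ r(J).  The rank of a set of columns is the size of a largest
-- nonzero minor supported on it, so it is monotone, vanishes on ∅, and grows by at most
-- one when a column x is added: Laplace expansion of a nonzero minor along the column
-- holding x yields a nonzero cofactor avoiding x.  Deleting columns of E one at a time
-- therefore realises every defect s ≤ r(E), and ι (s+1) < ι s: a largest set F of
-- defect s+1 misses some column x, and F ∪ {x} cannot have defect s+1 (F is largest),
-- so it has defect s.
-- The coefficient of t^d in f_i^m is a sum of terms indexed by J ⊆ K with |J| = n - i
-- and defect K = d.  For i = i_s, i.e. |J| = ι s, a term with d > s would need
-- ι s ≤ |K| ≤ ι d, while every term with d = s has |K| ≤ ι s = |J|, hence K = J and a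
-- positive value.  Conversely a nonzero coefficient of t^s gives n - i ≤ |K| ≤ ι s.

-- Laplace expansion

alt-+ : ∀ a b x → alt (a ℕ.+ b) x ≡ alt a (alt b x)
alt-+ zero    b x = refl
alt-+ (suc a) b x = cong -_ (alt-+ a b x)

alt-2+ : ∀ a x → alt (2 ℕ.+ a) x ≡ alt a x
alt-2+ a x = ℤ.neg-involutive (alt a x)

alt-suc+suc : ∀ a b x → alt (suc a ℕ.+ suc b) x ≡ alt (a ℕ.+ b) x
alt-suc+suc a b x = trans (cong (λ k → alt (suc k) x) (ℕ.+-suc a b)) (alt-2+ (a ℕ.+ b) x)

alt-0ℤ : ∀ k → alt k 0ℤ ≡ 0ℤ
alt-0ℤ zero    = refl
alt-0ℤ (suc k) = cong -_ (alt-0ℤ k)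

alt-distrib-+ : ∀ k x y → alt k (x + y) ≡ alt k x + alt k y
alt-distrib-+ zero    x y = refl
alt-distrib-+ (suc k) x y = trans (cong -_ (alt-distrib-+ k x y)) (ℤ.neg-distrib-+ (alt k x) (alt k y))

*-alt : ∀ k x y → x * alt k y ≡ alt k (x * y)
*-alt zero    x y = refl
*-alt (suc k) x y = trans (sym (ℤ.neg-distribʳ-* x (alt k y))) (cong -_ (*-alt k x y))

alt-*-alt : ∀ a b x y → alt a (x * alt b y) ≡ alt (a ℕ.+ b) (x * y)
alt-*-alt a b x y = trans (cong (alt a) (*-alt b x y)) (sym (alt-+ a b (x * y)))

alt-distrib-sum : ∀ k {n} (f : Fin n → ℤ) → alt k (sum f) ≡ ∑[ i < n ] alt k (f i)
alt-distrib-sum k {zero}  f = alt-0ℤ k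
alt-distrib-sum k {suc n} f =
  trans (alt-distrib-+ k (f zero) (sum (f ∘ suc))) (cong (alt k (f zero) +_) (alt-distrib-sum k (f ∘ suc)))

sumℤ-tabulate : ∀ {n} (f : Fin n → ℤ) → sumℤ (List.tabulate f) ≡ sum f
sumℤ-tabulate {zero}  f = refl
sumℤ-tabulate {suc n} f = cong (f zero +_) (sumℤ-tabulate (f ∘ suc))

sumℤ-allFin : ∀ {n} (f : Fin n → ℤ) → sumℤ (map f (allFin n)) ≡ sum f
sumℤ-allFin f = trans (cong sumℤ (List.map-tabulate id f)) (sumℤ-tabulate f)

Matrix : ℕ → ℕ → Set
Matrix p q = Fin p → Fin q → ℤ

minor : ∀ {t} → Matrix (suc t) (suc t) → Fin (suc t) → Fin (suc t) → Matrix t t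
minor M i j r c = M (punchIn i r) (punchIn j c)

det-cong : ∀ {t} {A B : Matrix t t} → (∀ a b → A a b ≡ B a b) → det A ≡ det B
det-cong {zero}  eq = refl
det-cong {suc t} eq = cong sumℤ (List.map-cong (λ j →
  cong (alt (toℕ j)) (cong₂ _*_ (eq zero j) (det-cong (λ r c → eq (suc r) (punchIn j c))))) (allFin (suc t)))

det-expandRow₀ : ∀ {t} (M : Matrix (suc t) (suc t)) →
  det M ≡ ∑[ j < suc t ] alt (toℕ j) (M zero j * det (minor M zero j))
det-expandRow₀ M = sumℤ-allFin (λ j → alt (toℕ j) (M zero j * det (minor M zero j)))

-- Once column punchIn p j is deleted, column p sits at position punchOut ne.
punchOut-parity : ∀ {t} (p : Fin (suc (suc t))) (j : Fin (suc t)) (ne : punchIn p j ≢ p) x →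
  alt (toℕ (punchIn p j) ℕ.+ toℕ (punchOut ne)) x ≡ alt (suc (toℕ p ℕ.+ toℕ j)) x
punchOut-parity zero    j       ne x = cong (λ k → alt (suc k) x) (ℕ.+-identityʳ (toℕ j))
punchOut-parity (suc p) zero    ne x =
  sym (trans (alt-2+ (toℕ p ℕ.+ 0) x) (cong (λ k → alt k x) (ℕ.+-identityʳ (toℕ p))))
punchOut-parity {suc t} (suc p) (suc j) ne x = begin
  alt (suc (toℕ (punchIn p j)) ℕ.+ suc (toℕ (punchOut (ne ∘ cong suc)))) x
    ≡⟨ alt-suc+suc (toℕ (punchIn p j)) _ x ⟩
  alt (toℕ (punchIn p j) ℕ.+ toℕ (punchOut (ne ∘ cong suc))) x
    ≡⟨ punchOut-parity p j (ne ∘ cong suc) x ⟩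
  alt (suc (toℕ p ℕ.+ toℕ j)) x
    ≡⟨ cong -_ (alt-suc+suc (toℕ p) (toℕ j) x) ⟨
  alt (suc (suc (toℕ p) ℕ.+ suc (toℕ j))) x ∎
  where open ≡-Reasoning

punchOut-sign : ∀ {t} (p : Fin (suc (suc t))) (j : Fin (suc t)) (ne : punchIn p j ≢ p) i x →
  alt (toℕ (punchIn p j) ℕ.+ (i ℕ.+ toℕ (punchOut ne))) x ≡ alt (suc (i ℕ.+ toℕ p ℕ.+ toℕ j)) x
punchOut-sign p j ne i x = begin
  alt (J ℕ.+ (i ℕ.+ q)) x          ≡⟨ cong (λ k → alt k x) (x+[y+z]≡y+[x+z] J i q) ⟩
  alt (i ℕ.+ (J ℕ.+ q)) x          ≡⟨ alt-+ i (J ℕ.+ q) x ⟩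
  alt i (alt (J ℕ.+ q) x)          ≡⟨ cong (alt i) (punchOut-parity p j ne x) ⟩
  alt i (alt (suc (P ℕ.+ j′)) x)   ≡⟨ alt-+ i (suc (P ℕ.+ j′)) x ⟨
  alt (i ℕ.+ suc (P ℕ.+ j′)) x     ≡⟨ cong (λ k → alt k x)
                                        (trans (ℕ.+-suc i _) (cong suc (sym (ℕ.+-assoc i P j′)))) ⟩
  alt (suc (i ℕ.+ P ℕ.+ j′)) x     ∎
  where
  open ≡-Reasoning
  J q P j′ : ℕ
  J = toℕ (punchIn p j)
  q = toℕ (punchOut ne)
  P = toℕ p
  j′ = toℕ j

punchIn-punchOut-punchIn : ∀ {t} (p : Fin (suc (suc t))) (j : Fin (suc t)) (ne : punchIn p j ≢ p) (c : Fin t) →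
  punchIn (punchIn p j) (punchIn (punchOut ne) c) ≡ punchIn p (punchIn j c)
punchIn-punchOut-punchIn zero    j       ne c = refl
punchIn-punchOut-punchIn (suc p) zero    ne c = refl
punchIn-punchOut-punchIn {suc t} (suc p) (suc j) ne zero    = refl
punchIn-punchOut-punchIn {suc t} (suc p) (suc j) ne (suc c) =
  cong suc (punchIn-punchOut-punchIn p j (ne ∘ cong suc) c)

-- Expand along row 0, expand each cofactor along the position of column p in it
-- (induction), and exchange the two sums.
det-expandCol : ∀ {t} (M : Matrix (suc t) (suc t)) (p : Fin (suc t)) →
  det M ≡ ∑[ i < suc t ] alt (toℕ i ℕ.+ toℕ p) (M i p * det (minor M i p))
det-expandCol {zero}  M zero = refl
det-expandCol {suc t} M p = begin
  det M                                       ≡⟨ det-expandRow₀ M ⟩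
  sum R                                       ≡⟨ sum-remove {i = p} R ⟩
  R p + ∑[ j < suc t ] R (punchIn p j)        ≡⟨ cong (R p +_) (sum-cong-≗ R∘punchIn) ⟩
  R p + ∑[ j < suc t ] ∑[ i < suc t ] X i j   ≡⟨ cong (R p +_) (∑-comm (λ j i → X i j)) ⟩
  R p + ∑[ i < suc t ] ∑[ j < suc t ] X i j   ≡⟨ cong (R p +_) (sum-cong-≗ C∘suc) ⟨
  R p + ∑[ i < suc t ] C (suc i)              ∎
  where
  open ≡-Reasoning
  R : Fin (suc (suc t)) → ℤ
  R j = alt (toℕ j) (M zero j * det (minor M zero j))
  C : Fin (suc (suc t)) → ℤ
  C i = alt (toℕ i ℕ.+ toℕ p) (M i p * det (minor M i p))
  a : Fin (suc t) → ℤ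
  a j = M zero (punchIn p j)
  b : Fin (suc t) → ℤ
  b i = M (suc i) p
  D : Fin (suc t) → Fin (suc t) → ℤ
  D i j = det (minor (minor M (suc i) p) zero j)
  X : Fin (suc t) → Fin (suc t) → ℤ
  X i j = alt (suc (toℕ i ℕ.+ toℕ p ℕ.+ toℕ j)) (a j * (b i * D i j))

  C∘suc : ∀ i → C (suc i) ≡ ∑[ j < suc t ] X i j
  C∘suc i = begin
    alt ℓ (b i * det (minor M (suc i) p))
      ≡⟨ cong (λ d → alt ℓ (b i * d)) (det-expandRow₀ (minor M (suc i) p)) ⟩
    alt ℓ (b i * ∑[ j < suc t ] alt (toℕ j) (a j * D i j))
      ≡⟨ cong (alt ℓ) (*-distribˡ-sum (b i) (λ j → alt (toℕ j) (a j * D i j))) ⟩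
    alt ℓ (∑[ j < suc t ] (b i * alt (toℕ j) (a j * D i j)))
      ≡⟨ alt-distrib-sum ℓ (λ j → b i * alt (toℕ j) (a j * D i j)) ⟩
    ∑[ j < suc t ] alt ℓ (b i * alt (toℕ j) (a j * D i j))
      ≡⟨ sum-cong-≗ (λ j → trans (alt-*-alt ℓ (toℕ j) (b i) (a j * D i j))
                                 (cong (alt (ℓ ℕ.+ toℕ j)) (x*[y*z]≡y*[x*z] (b i) (a j) (D i j)))) ⟩
    ∑[ j < suc t ] X i j ∎
    where
    ℓ : ℕ
    ℓ = suc (toℕ i) ℕ.+ toℕ p

  R∘punchIn : ∀ j → R (punchIn p j) ≡ ∑[ i < suc t ] X i j
  R∘punchIn j = begin
    alt J (a j * det (minor M zero (punchIn p j)))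
      ≡⟨ cong (λ d → alt J (a j * d)) (det-expandCol (minor M zero (punchIn p j)) q) ⟩
    alt J (a j * ∑[ i < suc t ] alt (toℕ i ℕ.+ toℕ q)
                   (M (suc i) (punchIn (punchIn p j) q) * det (minor (minor M zero (punchIn p j)) i q)))
      ≡⟨ cong (λ d → alt J (a j * d)) (sum-cong-≗ λ i → cong (alt (toℕ i ℕ.+ toℕ q)) (cong₂ _*_
           (cong (M (suc i)) (punchIn-punchOut ne))
           (det-cong λ r c → cong (M (suc (punchIn i r))) (punchIn-punchOut-punchIn p j ne c)))) ⟩
    alt J (a j * ∑[ i < suc t ] alt (toℕ i ℕ.+ toℕ q) (b i * D i j))
      ≡⟨ cong (alt J) (*-distribˡ-sum (a j) (λ i → alt (toℕ i ℕ.+ toℕ q) (b i * D i j))) ⟩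
    alt J (∑[ i < suc t ] (a j * alt (toℕ i ℕ.+ toℕ q) (b i * D i j)))
      ≡⟨ alt-distrib-sum J (λ i → a j * alt (toℕ i ℕ.+ toℕ q) (b i * D i j)) ⟩
    ∑[ i < suc t ] alt J (a j * alt (toℕ i ℕ.+ toℕ q) (b i * D i j))
      ≡⟨ sum-cong-≗ (λ i → trans (alt-*-alt J (toℕ i ℕ.+ toℕ q) (a j) (b i * D i j))
                                 (punchOut-sign p j ne (toℕ i) (a j * (b i * D i j)))) ⟩
    ∑[ i < suc t ] X i j ∎
    where
    J : ℕ
    J = toℕ (punchIn p j)
    ne : punchIn p j ≢ p
    ne = punchInᵢ≢i p j
    q : Fin (suc t)
    q = punchOut ne

det≢0⇒minor≢0 : ∀ {t} (M : Matrix (suc t) (suc t)) (p : Fin (suc t)) →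
  det M ≢ 0ℤ → ∃ λ i → det (minor M i p) ≢ 0ℤ
det≢0⇒minor≢0 {t} M p det≢0 =
  ¬∀⟶∃¬ (suc t) (λ i → det (minor M i p) ≡ 0ℤ) (λ i → det (minor M i p) ℤ.≟ 0ℤ) λ minors≡0 →
    det≢0 (begin
      det M                                                            ≡⟨ det-expandCol M p ⟩
      ∑[ i < suc t ] alt (toℕ i ℕ.+ toℕ p) (M i p * det (minor M i p)) ≡⟨ sum-cong-≗ (term≡0 minors≡0) ⟩
      ∑[ i < suc t ] 0ℤ                                                ≡⟨ sum-replicate-zero (suc t) ⟩
      0ℤ                                                               ∎)
  where
  open ≡-Reasoning
  term≡0 : (∀ i → det (minor M i p) ≡ 0ℤ) → ∀ i → alt (toℕ i ℕ.+ toℕ p) (M i p * det (minor M i p)) ≡ 0ℤ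
  term≡0 minors≡0 i rewrite minors≡0 i | ℤ.*-zeroʳ (M i p) = alt-0ℤ (toℕ i ℕ.+ toℕ p)

-- Rank as the size of a largest nonzero minor

StrictlyIncreasing : ∀ {a b} → (Fin a → Fin b) → Set
StrictlyIncreasing = Monotonic₁ Fin._<_ Fin._<_

module _ {a b} {f : Fin a → Fin b} (f↗ : StrictlyIncreasing f) where

  increasing⇒injective : ∀ {x y} → f x ≡ f y → x ≡ y
  increasing⇒injective {x} {y} eq with <-cmp x y
  ... | tri< x<y _ _ = ⊥-elim (ℕ.<-irrefl (cong toℕ eq) (f↗ x<y))
  ... | tri≈ _ x≡y _ = x≡y
  ... | tri> _ _ y<x = ⊥-elim (ℕ.<-irrefl (cong toℕ (sym eq)) (f↗ y<x))

  increasing⇒reflects-< : ∀ {x y} → f x Fin.< f y → x Fin.< y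
  increasing⇒reflects-< {x} {y} fx<fy with <-cmp x y
  ... | tri< x<y _ _  = x<y
  ... | tri≈ _ refl _ = ⊥-elim (ℕ.<-irrefl refl fx<fy)
  ... | tri> _ _ y<x  = ⊥-elim (ℕ.<-asym fx<fy (f↗ y<x))

punchIn-increasing : ∀ {t} (i : Fin (suc t)) → StrictlyIncreasing (punchIn i)
punchIn-increasing zero    x<y = s≤s x<y
punchIn-increasing (suc i) {zero}  {suc y} x<y       = s≤s z≤n
punchIn-increasing (suc i) {suc x} {suc y} (s≤s x<y) = s≤s (punchIn-increasing i x<y)

increasing-suc⁺ : ∀ {a b} {f : Fin a → Fin b} {g : Fin a → Fin (suc b)} →
  (∀ x → g x ≡ suc (f x)) → StrictlyIncreasing f → StrictlyIncreasing g
increasing-suc⁺ eq f↗ {x} {y} x<y = subst₂ Fin._<_ (sym (eq x)) (sym (eq y)) (s≤s (f↗ x<y))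

increasing-suc⁻ : ∀ {a b} {f : Fin a → Fin b} {g : Fin a → Fin (suc b)} →
  (∀ x → g x ≡ suc (f x)) → StrictlyIncreasing g → StrictlyIncreasing f
increasing-suc⁻ eq g↗ {x} {y} x<y = ℕ.≤-pred (subst₂ Fin._<_ (eq x) (eq y) (g↗ x<y))

increasing⇒suc≢0 : ∀ {a q} {f : Fin (suc a) → Fin (suc q)} → StrictlyIncreasing f → ∀ x → f (suc x) ≢ zero
increasing⇒suc≢0 {f = f} f↗ x eq =
  ℕ.n≮0 (subst (λ y → toℕ (f zero) ℕ.< toℕ y) eq (f↗ {zero} {suc x} (s≤s z≤n)))

module _ {a q} (f : Fin a → Fin (suc q)) (f≢0 : ∀ x → f x ≢ zero) where

  dropZero : Fin a → Fin q
  dropZero x = punchOut (f≢0 x ∘ sym)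

  dropZero-suc : ∀ x → f x ≡ suc (dropZero x)
  dropZero-suc x = sym (punchIn-punchOut (f≢0 x ∘ sym))

  map-suc-tabulate-dropZero : Vec.map suc (Vec.tabulate dropZero) ≡ Vec.tabulate f
  map-suc-tabulate-dropZero = trans (sym (Vec.tabulate-∘ suc dropZero)) (Vec.tabulate-cong (sym ∘ dropZero-suc))

zero∷suc : ∀ {t q} → Vec (Fin q) t → Vec (Fin (suc q)) (suc t)
zero∷suc w = zero ∷ Vec.map suc w

∈choose⇒increasing : ∀ {t q} {v : Vec (Fin q) t} → v ∈ choose t q → StrictlyIncreasing (Vec.lookup v)
∈choose⇒increasing {zero} _ {()}
∈choose⇒increasing {suc t} {suc q} v∈ with ∈-++⁻ (map (zero∷suc {q = q}) (choose t q)) v∈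
... | inj₁ v∈₁ with ∈-map⁻ zero∷suc v∈₁
...   | w , w∈ , refl = zero∷suc-↗
  where
  suc-↗ : StrictlyIncreasing (Vec.lookup (Vec.map suc w))
  suc-↗ = increasing-suc⁺ (λ x → Vec.lookup-map x suc w) (∈choose⇒increasing w∈)
  zero∷suc-↗ : StrictlyIncreasing (Vec.lookup (zero∷suc w))
  zero∷suc-↗ {zero}  {suc y} _         = subst (λ z → 0 ℕ.< toℕ z) (sym (Vec.lookup-map y suc w)) (s≤s z≤n)
  zero∷suc-↗ {suc x} {suc y} (s≤s x<y) = suc-↗ x<y
∈choose⇒increasing {suc t} {suc q} v∈ | inj₂ v∈₂ with ∈-map⁻ (Vec.map suc) v∈₂
...   | w , w∈ , refl = increasing-suc⁺ (λ x → Vec.lookup-map x suc w) (∈choose⇒increasing w∈)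

increasing⇒∈choose : ∀ {t q} (f : Fin t → Fin q) → StrictlyIncreasing f → Vec.tabulate f ∈ choose t q
increasing⇒∈choose {zero}          f f↗ = here refl
increasing⇒∈choose {suc t} {zero}  f f↗ with f zero
... | ()
increasing⇒∈choose {suc t} {suc q} f f↗ with f zero in f₀≡
... | zero  =
  ∈-++⁺ˡ (subst (_∈ map zero∷suc (choose t q)) (cong (zero ∷_) (map-suc-tabulate-dropZero f∘suc f∘suc≢0))
                (∈-map⁺ zero∷suc (increasing⇒∈choose (dropZero f∘suc f∘suc≢0) g↗)))
  where
  f∘suc : Fin t → Fin (suc q)
  f∘suc = f ∘ suc
  f∘suc≢0 : ∀ x → f∘suc x ≢ zero
  f∘suc≢0 = increasing⇒suc≢0 f↗
  g↗ : StrictlyIncreasing (dropZero f∘suc f∘suc≢0)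
  g↗ = increasing-suc⁻ (dropZero-suc f∘suc f∘suc≢0) (f↗ ∘ s≤s)
... | suc _ =
  ∈-++⁺ʳ (map zero∷suc (choose t q))
         (subst (_∈ map (Vec.map suc) (choose (suc t) q))
                (trans (map-suc-tabulate-dropZero f f≢0) (cong (Vec._∷ Vec.tabulate (f ∘ suc)) f₀≡))
                (∈-map⁺ (Vec.map suc) (increasing⇒∈choose (dropZero f f≢0) g↗)))
  where
  f≢0 : ∀ x → f x ≢ zero
  f≢0 zero    eq = case trans (sym f₀≡) eq of λ ()
  f≢0 (suc x) = increasing⇒suc≢0 f↗ x
  g↗ : StrictlyIncreasing (dropZero f f≢0)
  g↗ = increasing-suc⁻ (dropZero-suc f f≢0) f↗

gcdFold : List ℤ → ℕ
gcdFold = foldr (λ x g → gcd ℤ.∣ x ∣ g) 0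

gcdFold≢0⇒∃≢0 : ∀ xs → gcdFold xs ≢ 0 → ∃ λ x → x ∈ xs × x ≢ 0ℤ
gcdFold≢0⇒∃≢0 []       g≢0 = ⊥-elim (g≢0 refl)
gcdFold≢0⇒∃≢0 (x ∷ xs) g≢0 with x ℤ.≟ 0ℤ
... | no  x≢0  = x , here refl , x≢0
... | yes refl =
  let y , y∈ , y≢0 = gcdFold≢0⇒∃≢0 xs (g≢0 ∘ trans (gcd-identityˡ (gcdFold xs))) in y , there y∈ , y≢0

∈∧≢0⇒gcdFold≢0 : ∀ {x xs} → x ∈ xs → x ≢ 0ℤ → gcdFold xs ≢ 0
∈∧≢0⇒gcdFold≢0 (here refl) x≢0 g≡0 = x≢0 (ℤ.∣i∣≡0⇒i≡0 (gcd[m,n]≡0⇒m≡0 g≡0))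
∈∧≢0⇒gcdFold≢0 {xs = y ∷ _} (there x∈) x≢0 g≡0 =
  ∈∧≢0⇒gcdFold≢0 x∈ x≢0 (gcd[m,n]≡0⇒n≡0 ℤ.∣ y ∣ g≡0)

largest-sound : ∀ P N → P (largest P N) ≡ true ⊎ largest P N ≡ 0
largest-sound P zero    = inj₂ refl
largest-sound P (suc N) with P (suc N) in eq
... | true  = inj₁ eq
... | false = largest-sound P N

largest-maximal : ∀ P N {t} → t ≤ N → P t ≡ true → t ≤ largest P N
largest-maximal P zero    z≤n Pt = z≤n
largest-maximal P (suc N) {t} t≤N Pt with P (suc N) in eq | ℕ.m≤n⇒m<n∨m≡n t≤N
... | true  | _          = t≤N
... | false | inj₁ t<1+N = largest-maximal P N (ℕ.≤-pred t<1+N) Pt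
... | false | inj₂ refl  = case trans (sym Pt) eq of λ ()

not-≡ᵇ0⇒≢0 : ∀ {d} → not (d ℕ.≡ᵇ 0) ≡ true → d ≢ 0
not-≡ᵇ0⇒≢0 {suc d} _ ()

≢0⇒not-≡ᵇ0 : ∀ {d} → d ≢ 0 → not (d ℕ.≡ᵇ 0) ≡ true
≢0⇒not-≡ᵇ0 {zero}  d≢0 = ⊥-elim (d≢0 refl)
≢0⇒not-≡ᵇ0 {suc d} _   = refl

record NonzeroMinor {p q} (A : Matrix p q) (t : ℕ) : Set where
  field
    rows   : Fin t → Fin p
    cols   : Fin t → Fin q
    rows-↗ : StrictlyIncreasing rows
    cols-↗ : StrictlyIncreasing cols
    det≢0  : det (λ a b → A (rows a) (cols b)) ≢ 0ℤ

module _ {p q} (A : Matrix p q) where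

  emptyMinor : NonzeroMinor A 0
  emptyMinor = record { rows = λ () ; cols = λ () ; rows-↗ = λ {} ; cols-↗ = λ {} ; det≢0 = λ () }

  nonzeroMinor-size : ∀ {t} → NonzeroMinor A t → t ≤ p ⊓ q
  nonzeroMinor-size μ =
    ℕ.⊓-glb (injective⇒≤ (increasing⇒injective rows-↗)) (injective⇒≤ (increasing⇒injective cols-↗))
    where open NonzeroMinor μ

  minorAt : ∀ {t} → Vec (Fin p) t → Vec (Fin q) t → ℤ
  minorAt rs cs = det (λ a b → A (Vec.lookup rs a) (Vec.lookup cs b))

  ∈minors⇒nonzeroMinor : ∀ {t x} → x ∈ minors A t → x ≢ 0ℤ → NonzeroMinor A t
  ∈minors⇒nonzeroMinor {t} x∈ x≢0 =
    let rs , rs∈ , x∈rs = find (∈-concatMap⁻ (λ rs → map (minorAt rs) (choose t q)) {xs = choose t p} x∈)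
        cs , cs∈ , x≡   = ∈-map⁻ (minorAt rs) x∈rs
    in record { rows = Vec.lookup rs ; cols = Vec.lookup cs
              ; rows-↗ = ∈choose⇒increasing rs∈ ; cols-↗ = ∈choose⇒increasing cs∈ ; det≢0 = x≢0 ∘ trans x≡ }

  nonzeroMinor⇒∈minors : ∀ {t} → NonzeroMinor A t → ∃ λ x → x ∈ minors A t × x ≢ 0ℤ
  nonzeroMinor⇒∈minors {t} μ = minorAt rs cs , rs,cs∈ , det≢0 ∘ trans (det-cong λ a b →
    cong₂ A (sym (Vec.lookup∘tabulate rows a)) (sym (Vec.lookup∘tabulate cols b)))
    where
    open NonzeroMinor μ
    rs : Vec (Fin p) t
    rs = Vec.tabulate rows
    cs : Vec (Fin q) t
    cs = Vec.tabulate cols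
    rs,cs∈ : minorAt rs cs ∈ minors A t
    rs,cs∈ = ∈-concatMap⁺ (λ rs → map (minorAt rs) (choose t q))
               (Any.map (λ { refl → ∈-map⁺ (minorAt rs) (increasing⇒∈choose cols cols-↗) })
                        (increasing⇒∈choose rows rows-↗))

  detDiv≢0⇒nonzeroMinor : ∀ {t} → detDiv A t ≢ 0 → NonzeroMinor A t
  detDiv≢0⇒nonzeroMinor {t} d≢0 =
    let _ , x∈ , x≢0 = gcdFold≢0⇒∃≢0 (minors A t) d≢0 in ∈minors⇒nonzeroMinor x∈ x≢0

  nonzeroMinor⇒detDiv≢0 : ∀ {t} → NonzeroMinor A t → detDiv A t ≢ 0
  nonzeroMinor⇒detDiv≢0 μ = let _ , x∈ , x≢0 = nonzeroMinor⇒∈minors μ in ∈∧≢0⇒gcdFold≢0 x∈ x≢0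

  rank-nonzeroMinor : NonzeroMinor A (rank A)
  rank-nonzeroMinor =
    Sum.[ detDiv≢0⇒nonzeroMinor ∘ not-≡ᵇ0⇒≢0 , (λ rank≡0 → subst (NonzeroMinor A) (sym rank≡0) emptyMinor) ]′
        (largest-sound (λ t → not (detDiv A t ℕ.≡ᵇ 0)) (p ⊓ q))

  nonzeroMinor⇒≤rank : ∀ {t} → NonzeroMinor A t → t ≤ rank A
  nonzeroMinor⇒≤rank μ =
    largest-maximal _ (p ⊓ q) (nonzeroMinor-size μ) (≢0⇒not-≡ᵇ0 (nonzeroMinor⇒detDiv≢0 μ))

-- Ranks of column sets

AllPairs-lookup : ∀ {A : Set} {R : A → A → Set} {xs : List A} → AllPairs R xs →
  ∀ {i j} → i Fin.< j → R (List.lookup xs i) (List.lookup xs j)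
AllPairs-lookup (x∼xs ∷ _)  {zero}  {suc j} _         = All.lookup x∼xs (∈-lookup j)
AllPairs-lookup (_    ∷ xs) {suc i} {suc j} (s≤s i<j) = AllPairs-lookup xs i<j

module _ {n} (J : Subset n) where

  column : Fin (length (elems J)) → Fin n
  column = List.lookup (elems J)

  column-↗ : StrictlyIncreasing column
  column-↗ = AllPairs-lookup (AllPairs.filter⁺ (_∈? J) (AllPairs.tabulate⁺-< {R = Fin._<_} {f = id} id))

  column-∈ : ∀ c → column c ∈ₛ J
  column-∈ c = proj₂ (∈-filter⁻ (_∈? J) {xs = allFin n} (∈-lookup c))

  column-onto : ∀ {y} → y ∈ₛ J → ∃ λ c → column c ≡ y
  column-onto {y} y∈J = index y∈ , sym (lookup-index y∈)
    where
    y∈ : y ∈ elems J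
    y∈ = ∈-filter⁺ (_∈? J) (∈-allFin y) y∈J

∈∪⁅⁆⁻ : ∀ {n} {J : Subset n} {x y} → y ∈ₛ J ∪ ⁅ x ⁆ → y ∈ₛ J ⊎ y ≡ x
∈∪⁅⁆⁻ {J = J} {x} = Sum.map₂ (x∈⁅y⁆⇒x≡y x) ∘ x∈p∪q⁻ J ⁅ x ⁆

⊆-∪⁅⁆ : ∀ {n} {J : Subset n} {x} → J ⊆ (J - x) ∪ ⁅ x ⁆
⊆-∪⁅⁆ {x = x} {y} y∈J with y ≟ x
... | yes refl = x∈p∪q⁺ (inj₂ (x∈⁅x⁆ x))
... | no  y≢x  = x∈p∪q⁺ (inj₁ (x∈p∧x≢y⇒x∈p-y y∈J y≢x))

module _ {k n} (G : Matrix k n) where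

  NonzeroMinorIn : Subset n → ℕ → Set
  NonzeroMinorIn J t = Σ[ μ ∈ NonzeroMinor G t ] (∀ b → NonzeroMinor.cols μ b ∈ₛ J)

  sub-minor⇒minorIn : ∀ J {t} → NonzeroMinor (sub G J) t → NonzeroMinorIn J t
  sub-minor⇒minorIn J μ = record
    { rows = rows ; cols = column J ∘ cols
    ; rows-↗ = rows-↗ ; cols-↗ = column-↗ J ∘ cols-↗ ; det≢0 = det≢0 } , column-∈ J ∘ cols
    where open NonzeroMinor μ

  minorIn⇒sub-minor : ∀ J {t} → NonzeroMinorIn J t → NonzeroMinor (sub G J) t
  minorIn⇒sub-minor J {t} (μ , cols∈J) = record
    { rows = rows ; cols = γ
    ; rows-↗ = rows-↗
    ; cols-↗ = increasing⇒reflects-< (column-↗ J) ∘ subst₂ Fin._<_ (sym (γ-column _)) (sym (γ-column _)) ∘ cols-↗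
    ; det≢0 = det≢0 ∘ trans (det-cong λ a b → cong (G (rows a)) (sym (γ-column b))) }
    where
    open NonzeroMinor μ
    γ : Fin t → Fin (length (elems J))
    γ b = proj₁ (column-onto J (cols∈J b))
    γ-column : ∀ b → column J (γ b) ≡ cols b
    γ-column b = proj₂ (column-onto J (cols∈J b))

  r-nonzeroMinorIn : ∀ J → NonzeroMinorIn J (r G J)
  r-nonzeroMinorIn J = sub-minor⇒minorIn J (rank-nonzeroMinor (sub G J))

  nonzeroMinorIn⇒≤r : ∀ J {t} → NonzeroMinorIn J t → t ≤ r G J
  nonzeroMinorIn⇒≤r J μ = nonzeroMinor⇒≤rank (sub G J) (minorIn⇒sub-minor J μ)

  r-mono : ∀ {J K} → J ⊆ K → r G J ≤ r G K
  r-mono {J} {K} J⊆K = let μ , cols∈J = r-nonzeroMinorIn J in nonzeroMinorIn⇒≤r K (μ , J⊆K ∘ cols∈J)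

  rE≤r⊤ : rE G ≤ r G ⊤
  rE≤r⊤ = nonzeroMinorIn⇒≤r ⊤ (rank-nonzeroMinor G , λ _ → ∈⊤)

  minorIn-empty : ∀ {J t} → Empty J → NonzeroMinorIn J t → t ≡ 0
  minorIn-empty {t = zero}  _       _            = refl
  minorIn-empty {t = suc t} J-empty (_ , cols∈J) = ⊥-elim (J-empty (_ , cols∈J zero))

  r-empty : ∀ {J} → Empty J → r G J ≡ 0
  r-empty {J} J-empty = minorIn-empty J-empty (r-nonzeroMinorIn J)

  -- Expanding along the column that holds x, if any, leaves a nonzero cofactor avoiding x.
  minorIn-dropColumn : ∀ {J K x t} → K ⊆ J ∪ ⁅ x ⁆ → NonzeroMinorIn K (suc t) → NonzeroMinorIn J t
  minorIn-dropColumn {J} {K} {x} {t} K⊆J∪x (μ , cols∈K) = μ′ , cols′∈J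
    where
    open NonzeroMinor μ
    column-avoiding-x : Σ[ p ∈ Fin (suc t) ] (∀ c → cols (punchIn p c) ≢ x)
    column-avoiding-x with any? (λ b → cols b ≟ x)
    ... | yes (p , cols-p≡x) = p , λ c eq → punchInᵢ≢i p c (increasing⇒injective cols-↗ (trans eq (sym cols-p≡x)))
    ... | no  x∉cols         = zero , λ c eq → x∉cols (_ , eq)
    p : Fin (suc t)
    p = proj₁ column-avoiding-x
    nonzero-cofactor : ∃ λ i → det (minor (λ a b → G (rows a) (cols b)) i p) ≢ 0ℤ
    nonzero-cofactor = det≢0⇒minor≢0 (λ a b → G (rows a) (cols b)) p det≢0
    i : Fin (suc t)
    i = proj₁ nonzero-cofactor
    μ′ : NonzeroMinor G t
    μ′ = record
      { rows = rows ∘ punchIn i ; cols = cols ∘ punchIn p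
      ; rows-↗ = rows-↗ ∘ punchIn-increasing i ; cols-↗ = cols-↗ ∘ punchIn-increasing p
      ; det≢0 = proj₂ nonzero-cofactor }
    cols′∈J : ∀ c → cols (punchIn p c) ∈ₛ J
    cols′∈J c with ∈∪⁅⁆⁻ (K⊆J∪x (cols∈K (punchIn p c)))
    ... | inj₁ y∈J = y∈J
    ... | inj₂ y≡x = ⊥-elim (proj₂ column-avoiding-x c y≡x)

  r-addColumn : ∀ {J K x} → K ⊆ J ∪ ⁅ x ⁆ → r G K ≤ suc (r G J)
  r-addColumn {J} {K} K⊆J∪x = bound (r-nonzeroMinorIn K)
    where
    bound : ∀ {t} → NonzeroMinorIn K t → t ≤ suc (r G J)
    bound {zero}  _ = z≤n
    bound {suc t} μ = s≤s (nonzeroMinorIn⇒≤r J (minorIn-dropColumn K⊆J∪x μ))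

module _ {n} (f : Subset n → ℕ) (f-empty : ∀ {J} → Empty J → f J ≡ 0)
         (f-remove : ∀ {J x} → f J ≤ suc (f (J - x))) where

  intermediate-value : ∀ J {v} → v ≤ f J → ∃ λ J′ → f J′ ≡ v
  intermediate-value J = go (suc n) J (s≤s (∣p∣≤n J))
    where
    go : ∀ s J {v} → ∣ J ∣ < s → v ≤ f J → ∃ λ J′ → f J′ ≡ v
    go (suc s) J {v} ∣J∣<1+s v≤fJ with nonempty? J
    ... | no J-empty = J , trans fJ≡0 (sym (ℕ.n≤0⇒n≡0 (subst (v ≤_) fJ≡0 v≤fJ)))
      where
      fJ≡0 : f J ≡ 0
      fJ≡0 = f-empty J-empty
    ... | yes (x , x∈J) with v ℕ.≤? f (J - x)
    ...   | yes v≤ = go s (J - x) (ℕ.<-≤-trans (x∈p⇒∣p-x∣<∣p∣ x∈J) (ℕ.≤-pred ∣J∣<1+s)) v≤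
    ...   | no  v≰ = J , ℕ.≤-antisym (ℕ.≤-trans f-remove (ℕ.≰⇒> v≰)) v≤fJ

-- The maximal sizes ι s

allSubsets-complete : ∀ {n} (J : Subset n) → J ∈ allSubsets n
allSubsets-complete []                    = here refl
allSubsets-complete {suc n} (outside ∷ J) = ∈-++⁺ˡ (∈-map⁺ (outside ∷_) (allSubsets-complete J))
allSubsets-complete {suc n} (inside ∷ J)  =
  ∈-++⁺ʳ (map (outside ∷_) (allSubsets n)) (∈-map⁺ (inside ∷_) (allSubsets-complete J))

≤foldr-⊔ : ∀ {x xs} → x ∈ xs → x ≤ foldr _⊔_ 0 xs
≤foldr-⊔ {xs = y ∷ ys} (here refl) = ℕ.m≤m⊔n y (foldr _⊔_ 0 ys)
≤foldr-⊔ {xs = y ∷ ys} (there x∈)  = ℕ.≤-trans (≤foldr-⊔ x∈) (ℕ.m≤n⊔m y (foldr _⊔_ 0 ys))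

module _ {k n} (G : Matrix k n) where

  defect : Subset n → ℕ
  defect J = rE G ∸ r G J

  ι-upper : ∀ {s} J → defect J ≡ s → ∣ J ∣ ≤ ι G s
  ι-upper {s} J J-s = ≤foldr-⊔ (∈-map⁺ ∣_∣ (∈-filter⁺ (λ J → defect J ℕ.≟ s) (allSubsets-complete J) J-s))

  ι-selective : ∀ s → ι G s ≡ 0 ⊎ ∃ λ J → defect J ≡ s × ∣ J ∣ ≡ ι G s
  ι-selective s = Sum.map₂ attained (foldr-selective ℕ.⊔-sel 0 (map ∣_∣ defect-s))
    where
    defect-s : List (Subset n)
    defect-s = filter (λ J → defect J ℕ.≟ s) (allSubsets n)
    attained : ι G s ∈ map ∣_∣ defect-s → ∃ λ J → defect J ≡ s × ∣ J ∣ ≡ ι G s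
    attained ι∈ = let J , J∈ , ι≡∣J∣ = ∈-map⁻ ∣_∣ ι∈ in
      J , proj₂ (∈-filter⁻ (λ J → defect J ℕ.≟ s) {xs = allSubsets n} J∈) , sym ι≡∣J∣

  ι≤n : ∀ s → ι G s ≤ n
  ι≤n s = Sum.[ (λ ι≡0 → subst (_≤ n) (sym ι≡0) z≤n) , (λ (J , _ , ∣J∣≡ι) → subst (_≤ n) ∣J∣≡ι (∣p∣≤n J)) ]′
              (ι-selective s)

  ι-attained : ∀ {s} J → defect J ≡ s → ∃ λ J′ → defect J′ ≡ s × ∣ J′ ∣ ≡ ι G s
  ι-attained {s} J J-s = Sum.[ J-attains , id ]′ (ι-selective s)
    where
    J-attains : ι G s ≡ 0 → ∃ λ J′ → defect J′ ≡ s × ∣ J′ ∣ ≡ ι G s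
    J-attains ι≡0 = J , J-s , trans (ℕ.n≤0⇒n≡0 (subst (∣ J ∣ ≤_) ι≡0 (ι-upper J J-s))) (sym ι≡0)

  defect-onto : ∀ {s} → s ≤ rE G → ∃ λ J → defect J ≡ s
  defect-onto {s} s≤rE =
    let J , rJ≡ = intermediate-value (r G) (r-empty G) (r-addColumn G ⊆-∪⁅⁆) ⊤
                                     (ℕ.≤-trans (ℕ.m∸n≤m (rE G) s) (rE≤r⊤ G))
    in J , trans (cong (rE G ∸_) rJ≡) (ℕ.m∸[m∸n]≡n s≤rE)

  ι-witness : ∀ {s} → s ≤ rE G → ∃ λ J → defect J ≡ s × ∣ J ∣ ≡ ι G s
  ι-witness s≤rE = let J , J-s = defect-onto s≤rE in ι-attained J J-s

  defect≢0⇒∃∉ : ∀ {F} → defect F ≢ 0 → ∃ λ x → x ∉ₛ F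
  defect≢0⇒∃∉ {F} F≢0 with all? (_∈? F)
  ... | no  ¬all∈ = ¬∀⟶∃¬ n (_∈ₛ F) (_∈? F) ¬all∈
  ... | yes all∈  = ⊥-elim (F≢0 (ℕ.m≤n⇒m∸n≡0 (ℕ.≤-trans (rE≤r⊤ G) (r-mono G (λ {x} _ → all∈ x)))))

  ι-step : ∀ {s F x} → defect F ≡ suc s → ∣ F ∣ ≡ ι G (suc s) → x ∉ₛ F → ι G (suc s) < ι G s
  ι-step {s} {F} {x} F-1+s ∣F∣≡ι x∉F =
    Sum.[ grows , ⊥-elim ∘ stays ]′ (ℕ.m≤n⇒m<n∨m≡n (r-mono G F⊆F′))
    where
    open ℕ.≤-Reasoning
    F′ : Subset n
    F′ = F ∪ ⁅ x ⁆
    F⊆F′ : F ⊆ F′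
    F⊆F′ = p⊆p∪q ⁅ x ⁆
    ∣F∣<∣F′∣ : ∣ F ∣ < ∣ F′ ∣
    ∣F∣<∣F′∣ = p⊂q⇒∣p∣<∣q∣ (F⊆F′ , x , x∈p∪q⁺ (inj₂ (x∈⁅x⁆ x)) , x∉F)

    stays : r G F ≡ r G F′ → ⊥
    stays rF≡rF′ = ℕ.n≮n ∣ F ∣ (begin-strict
      ∣ F ∣         <⟨ ∣F∣<∣F′∣ ⟩
      ∣ F′ ∣        ≤⟨ ι-upper F′ (trans (cong (rE G ∸_) (sym rF≡rF′)) F-1+s) ⟩
      ι G (suc s)   ≡⟨ ∣F∣≡ι ⟨
      ∣ F ∣         ∎)

    grows : r G F < r G F′ → ι G (suc s) < ι G s
    grows rF<rF′ = begin-strict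
      ι G (suc s)   ≡⟨ ∣F∣≡ι ⟨
      ∣ F ∣         <⟨ ∣F∣<∣F′∣ ⟩
      ∣ F′ ∣        ≤⟨ ι-upper F′ F′-s ⟩
      ι G s         ∎
      where
      F′-s : defect F′ ≡ s
      F′-s = begin-equality
        rE G ∸ r G F′      ≡⟨ cong (rE G ∸_) (ℕ.≤-antisym (r-addColumn G id) rF<rF′) ⟩
        rE G ∸ suc (r G F) ≡⟨ ℕ.pred[m∸n]≡m∸[1+n] (rE G) (r G F) ⟨
        ℕ.pred (defect F)  ≡⟨ cong ℕ.pred F-1+s ⟩
        s                  ∎

  ι-suc< : ∀ {s} → suc s ≤ rE G → ι G (suc s) < ι G s
  ι-suc< {s} 1+s≤rE =
    let F , F-1+s , ∣F∣≡ι = ι-witness 1+s≤rE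
        x , x∉F           = defect≢0⇒∃∉ {F} (λ F-0 → case trans (sym F-1+s) F-0 of λ ())
    in ι-step F-1+s ∣F∣≡ι x∉F

  ι-decreasing : ∀ {s d} → s < d → d ≤ rE G → ι G d < ι G s
  ι-decreasing {s} {suc d} (s≤s s≤d) 1+d≤rE with ℕ.m≤n⇒m<n∨m≡n s≤d
  ... | inj₁ s<d  = ℕ.<-trans (ι-suc< 1+d≤rE) (ι-decreasing s<d (ℕ.<⇒≤ 1+d≤rE))
  ... | inj₂ refl = ι-suc< 1+d≤rE

-- The coefficients of f_i^m

sum≡0 : ∀ {xs} → All (_≡ 0ℚ) xs → foldr ℚ._+_ 0ℚ xs ≡ 0ℚ
sum≡0 []            = refl
sum≡0 (refl ∷ xs≡0) = trans (ℚ.+-identityˡ _) (sum≡0 xs≡0)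

sum≢0⇒∃≢0 : ∀ xs → foldr ℚ._+_ 0ℚ xs ≢ 0ℚ → ∃ λ x → x ∈ xs × x ≢ 0ℚ
sum≢0⇒∃≢0 []       Σ≢0 = ⊥-elim (Σ≢0 refl)
sum≢0⇒∃≢0 (x ∷ xs) Σ≢0 with x ℚ.≟ 0ℚ
... | no  x≢0  = x , here refl , x≢0
... | yes refl =
  let y , y∈ , y≢0 = sum≢0⇒∃≢0 xs (Σ≢0 ∘ trans (ℚ.+-identityˡ _)) in y , there y∈ , y≢0

sum-nonneg : ∀ {xs} → All (0ℚ ℚ.≤_) xs → 0ℚ ℚ.≤ foldr ℚ._+_ 0ℚ xs
sum-nonneg []           = ℚ.≤-refl
sum-nonneg (x≥0 ∷ xs≥0) = ℚ.+-mono-≤ x≥0 (sum-nonneg xs≥0)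

sum-pos : ∀ {x xs} → All (0ℚ ℚ.≤_) xs → x ∈ xs → 0ℚ ℚ.< x → 0ℚ ℚ.< foldr ℚ._+_ 0ℚ xs
sum-pos (_   ∷ xs≥0) (here refl) x>0 = ℚ.+-mono-<-≤ x>0 (sum-nonneg xs≥0)
sum-pos (y≥0 ∷ xs≥0) (there x∈)  x>0 = ℚ.+-mono-≤-< y≥0 (sum-pos xs≥0 x∈ x>0)

≡ᵇ-true⇒≡ : ∀ {a b} → (a ℕ.≡ᵇ b) ≡ true → a ≡ b
≡ᵇ-true⇒≡ {a} {b} eq = ℕ.≡ᵇ⇒≡ a b (subst T (sym eq) tt)

module _ {k n} (G : Matrix k n) {m : ℕ} (1≤m : 1 ≤ m) where

  -- coeff G m i d unfolds to the sum of terms i d.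
  term : Subset n → Subset n → ℕ → ℚ
  term J K d = if defect G K ℕ.≡ᵇ d
               then frac G (alt (∣ K ∣ ∸ ∣ J ∣) (ℤ.+ gprod G m K)) (gprod G m ⊤)
               else 0ℚ

  terms : ℕ → ℕ → List ℚ
  terms i d = concatMap (λ J → map (λ K → term J K d) (filter (J ⊆?_) (allSubsets n)))
                        (filter (λ J → ∣ J ∣ ℕ.≟ (n ∸ i)) (allSubsets n))

  IsTerm : ℕ → ℕ → ℚ → Set
  IsTerm i d x = ∃₂ λ J K → ∣ J ∣ ≡ n ∸ i × J ⊆ K × x ≡ term J K d

  ∈terms⁻ : ∀ i d {x} → x ∈ terms i d → IsTerm i d x
  ∈terms⁻ i d x∈ =
    let J , J∈ , x∈J = find (∈-concatMap⁻ (λ J → map (λ K → term J K d) (filter (J ⊆?_) (allSubsets n)))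
                                          {xs = filter (λ J → ∣ J ∣ ℕ.≟ (n ∸ i)) (allSubsets n)} x∈)
        K , K∈ , x≡ = ∈-map⁻ (λ K → term J K d) x∈J
    in J , K , proj₂ (∈-filter⁻ (λ J → ∣ J ∣ ℕ.≟ (n ∸ i)) {xs = allSubsets n} J∈)
             , proj₂ (∈-filter⁻ (J ⊆?_) {xs = allSubsets n} K∈) , x≡

  ∈terms⁺ : ∀ i d {J K} → ∣ J ∣ ≡ n ∸ i → J ⊆ K → term J K d ∈ terms i d
  ∈terms⁺ i d {J} {K} ∣J∣≡ J⊆K =
    ∈-concatMap⁺ (λ J → map (λ K → term J K d) (filter (J ⊆?_) (allSubsets n)))
      (Any.map (λ { refl → ∈-map⁺ (λ K → term J K d) (∈-filter⁺ (J ⊆?_) (allSubsets-complete K) J⊆K) })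
               (∈-filter⁺ (λ J → ∣ J ∣ ℕ.≟ (n ∸ i)) (allSubsets-complete J) ∣J∣≡))

  gprod-pos : ∀ J → 0 < gprod G m J
  gprod-pos J = ℕ.>-nonZero⁻¹ _ {{product≢0 (All.map⁺ (All.universal (λ _ → gcd≢0) (upTo (r G J))))}}
    where
    gcd≢0 : ∀ {x} → NonZero (gcd m x)
    gcd≢0 = ℕ.≢-nonZero (gcd[m,n]≢0 m _ (inj₁ (ℕ.n>0⇒n≢0 1≤m)))

  frac-nonneg : ∀ g d → 0ℚ ℚ.≤ frac G (ℤ.+ g) d
  frac-nonneg g zero    = ℚ.≤-refl
  frac-nonneg g (suc d) = ℚ.nonNegative⁻¹ _ {{ℚ.normalize-nonNeg g (suc d)}}

  frac-pos : ∀ {g d} → 0 < g → 0 < d → 0ℚ ℚ.< frac G (ℤ.+ g) d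
  frac-pos {suc g} {suc d} _ _ = ℚ.positive⁻¹ _ {{ℚ.normalize-pos (suc g) (suc d)}}

  term≢0⇒defect≡ : ∀ {J K d} → term J K d ≢ 0ℚ → defect G K ≡ d
  term≢0⇒defect≡ {J} {K} {d} term≢0 with defect G K ℕ.≡ᵇ d in eq
  ... | true  = ≡ᵇ-true⇒≡ eq
  ... | false = ⊥-elim (term≢0 refl)

  term-diagonal-pos : ∀ {J d} → defect G J ≡ d → 0ℚ ℚ.< term J J d
  term-diagonal-pos {J} {d} J-d with defect G J ℕ.≡ᵇ d in eq
  ... | true rewrite ℕ.n∸n≡0 ∣ J ∣ = frac-pos (gprod-pos J) (gprod-pos ⊤)
  ... | false = ⊥-elim (subst T eq (ℕ.≡⇒≡ᵇ _ _ J-d))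

  term-nonneg : ∀ {s J K} → ∣ J ∣ ≡ ι G s → 0ℚ ℚ.≤ term J K s
  term-nonneg {s} {J} {K} ∣J∣≡ι with defect G K ℕ.≡ᵇ s in eq
  ... | false = ℚ.≤-refl
  ... | true rewrite ℕ.m≤n⇒m∸n≡0 (subst (∣ K ∣ ≤_) (sym ∣J∣≡ι) (ι-upper G K (≡ᵇ-true⇒≡ eq))) =
    frac-nonneg (gprod G m K) (gprod G m ⊤)

  term-vanishes : ∀ {s d J K} → s < d → ∣ J ∣ ≡ ι G s → J ⊆ K → term J K d ≡ 0ℚ
  term-vanishes {s} {d} {J} {K} s<d ∣J∣≡ι J⊆K with defect G K ℕ.≡ᵇ d in eq
  ... | false = refl
  ... | true  = ⊥-elim (ℕ.n≮n (ι G s) (begin-strict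
      ι G s   ≡⟨ ∣J∣≡ι ⟨
      ∣ J ∣   ≤⟨ p⊆q⇒∣p∣≤∣q∣ J⊆K ⟩
      ∣ K ∣   ≤⟨ ι-upper G K K-d ⟩
      ι G d   <⟨ ι-decreasing G s<d (subst (_≤ rE G) K-d (ℕ.m∸n≤m (rE G) (r G K))) ⟩
      ι G s   ∎))
    where
    open ℕ.≤-Reasoning
    K-d : defect G K ≡ d
    K-d = ≡ᵇ-true⇒≡ eq

  isTerm-support : ∀ {i s x} → IsTerm i s x → x ≢ 0ℚ → n ∸ i ≤ ι G s
  isTerm-support {i} {s} (J , K , ∣J∣≡ , J⊆K , refl) x≢0 = begin
    n ∸ i   ≡⟨ ∣J∣≡ ⟨
    ∣ J ∣   ≤⟨ p⊆q⇒∣p∣≤∣q∣ J⊆K ⟩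
    ∣ K ∣   ≤⟨ ι-upper G K (term≢0⇒defect≡ {J} {K} x≢0) ⟩
    ι G s   ∎
    where open ℕ.≤-Reasoning

  module _ {s : ℕ} where

    n∸iₛ≡ι : n ∸ iₛ G s ≡ ι G s
    n∸iₛ≡ι = ℕ.m∸[m∸n]≡n (ι≤n G s)

    isTerm-nonneg : ∀ {x} → IsTerm (iₛ G s) s x → 0ℚ ℚ.≤ x
    isTerm-nonneg (J , K , ∣J∣≡ , _ , refl) = term-nonneg {s} {J} {K} (trans ∣J∣≡ n∸iₛ≡ι)

    isTerm-vanishes : ∀ {d x} → s < d → IsTerm (iₛ G s) d x → x ≡ 0ℚ
    isTerm-vanishes {d} s<d (J , K , ∣J∣≡ , J⊆K , refl) =
      term-vanishes {s} {d} {J} {K} s<d (trans ∣J∣≡ n∸iₛ≡ι) J⊆K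

    iₛ-hasDegree : s ≤ rE G → HasDegree G m (iₛ G s) s
    iₛ-hasDegree s≤rE = leading≢0 , λ d s<d → sum≡0 (All.tabulate (isTerm-vanishes s<d ∘ ∈terms⁻ (iₛ G s) d))
      where
      leading≢0 : coeff G m (iₛ G s) s ≢ 0ℚ
      leading≢0 =
        let J₀ , J₀-s , ∣J₀∣≡ι = ι-witness G s≤rE
            J₀-term = ∈terms⁺ (iₛ G s) s (trans ∣J₀∣≡ι (sym n∸iₛ≡ι)) ⊆-refl
        in ≢-sym (ℚ.<⇒≢ (sum-pos (All.tabulate (isTerm-nonneg ∘ ∈terms⁻ (iₛ G s) s)) J₀-term
                                  (term-diagonal-pos {J₀} J₀-s)))

  hasDegree⇒iₛ≤ : ∀ {s i} → i ≤ n → HasDegree G m i s → iₛ G s ≤ i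
  hasDegree⇒iₛ≤ {s} {i} i≤n (coeff≢0 , _) =
    let x , x∈ , x≢0 = sum≢0⇒∃≢0 (terms i s) coeff≢0
    in begin
      n ∸ ι G s     ≤⟨ ℕ.∸-monoʳ-≤ n (isTerm-support {i} {s} (∈terms⁻ i s x∈) x≢0) ⟩
      n ∸ (n ∸ i)   ≡⟨ ℕ.m∸[m∸n]≡n i≤n ⟩
      i             ∎
    where open ℕ.≤-Reasoning

lemma3p7 : (k n : ℕ) (G : Fin k → Fin n → ℤ)
    → (∀ j → ∃ λ i → G i j ≢ 0ℤ)
    → (m : ℕ) → 1 ≤ m → m ≤ ρ₀ G
    → (∀ s → s < rE G → iₛ G s < iₛ G (suc s))
      × (∀ s → s ≤ rE G → HasDegree G m (iₛ G s) s)
      × (∀ s i → s ≤ rE G → i ≤ n → HasDegree G m i s → iₛ G s ≤ i)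
lemma3p7 k n G _ m 1≤m _ =
    (λ s 1+s≤rE → ℕ.∸-monoʳ-< (ι-suc< G 1+s≤rE) (ι≤n G s))
  , (λ s s≤rE → iₛ-hasDegree G 1≤m s≤rE)
  , (λ s i _ i≤n → hasDegree⇒iₛ≤ G 1≤m i≤n)
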